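{- Let $\sigma,\tau\in S_n$. If $hd(\sigma^{CT},\tau^{CT})=hd(\sigma,\tau)-2$, then (i) $n-1$ lies in a cycle $C$ of length at least two in the cycle decomposition of $\sigma^{ -1}\tau$, and (ii) the cycle decomposition of $(\sigma^{CT})^{ -1}\tau^{CT}$ is the same as that of $\sigma^{ -1}\tau$ except that the cycle $C$ has its length decreased by two, by removing $n-1$ and either the next or the previous element in $C$.
   Context: $S_m$ is the symmetric group on $Z_m=\{0,1,\dots,m-1\}$, with composition $(\pi\sigma)(i)=\sigma(\pi(i))$. For $\sigma\in S_n$, its contraction $\sigma^{CT}\in S_{n-1}$ is defined for $0\le x\le n-2$ by $\sigma^{CT}(x)=\sigma(x)$ if $\sigma(x)\ne n-1$, and $\sigma^{CT}(x)=\sigma(n-1)$ if $\sigma(x)=n-1$. The Hamming distance $hd(\pi,\sigma)$ is the number of points $x$ with $\pi(x)\ne\sigma(x)$. -}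

module Defs where

open import Data.Nat using (ℕ; zero; suc; _+_)
open import Data.Fin using (Fin; fromℕ; inject₁; toℕ; lower₁; _≟_)
open import Data.Fin.Properties using (fromℕ≢inject₁; toℕ-fromℕ; toℕ-injective; inject₁-lower₁; inject₁-injective)
open import Data.Fin.Permutation using (Permutation′; permutation; _⟨$⟩ʳ_; _⟨$⟩ˡ_; inverseˡ; inverseʳ)
open import Relation.Binary.PropositionalEquality using (_≡_; _≢_; refl; sym; trans; cong)
open import Relation.Nullary using (yes; no; ¬_)
open import Function using (_∘_)
open import Data.Empty using (⊥-elim)

-- Conventions:
--  * Z_n = Fin n, S_n = Permutation′ n; σ ⟨$⟩ʳ x is σ(x), σ ⟨$⟩ˡ x is σ⁻¹(x).
--  * Composition (πσ)(i) = σ(π(i)), so (σ⁻¹τ)(x) = τ(σ⁻¹(x)).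
--  * n = suc m, and the point n-1 is  fromℕ m  (the last element of Fin (suc m)).

hdF : ∀ {n k} → (Fin n → Fin k) → (Fin n → Fin k) → ℕ
hdF {zero}  f g = 0
hdF {suc n} f g with f Fin.zero ≟ g Fin.zero
... | yes _ = hdF (f ∘ Fin.suc) (g ∘ Fin.suc)
... | no  _ = suc (hdF (f ∘ Fin.suc) (g ∘ Fin.suc))

hd : ∀ {n} → Permutation′ n → Permutation′ n → ℕ
hd π σ = hdF (π ⟨$⟩ʳ_) (σ ⟨$⟩ʳ_)

ctF : ∀ {m} → (Fin (suc m) → Fin (suc m)) → Fin m → Fin (suc m)
ctF {m} f x with f (inject₁ x) ≟ fromℕ m
... | yes _ = f (fromℕ m)
... | no  _ = f (inject₁ x)

private
  ≢last : ∀ {m} {v : Fin (suc m)} → v ≢ fromℕ m → m ≢ toℕ v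
  ≢last {m} {v} ne eq = ne (toℕ-injective (trans (sym eq) (sym (toℕ-fromℕ m))))

  ctF≢ : ∀ {m} (f g : Fin (suc m) → Fin (suc m)) → (∀ x → g (f x) ≡ x) →
         ∀ x → ctF f x ≢ fromℕ m
  ctF≢ {m} f g gf x with f (inject₁ x) ≟ fromℕ m
  ... | yes e = λ e′ → fromℕ≢inject₁
          (trans (sym (gf (fromℕ m))) (trans (cong g (trans e′ (sym e))) (gf (inject₁ x))))
  ... | no ne = ne

ctFun : ∀ {m} (f g : Fin (suc m) → Fin (suc m)) → (∀ x → g (f x) ≡ x) → Fin m → Fin m
ctFun f g gf x = lower₁ (ctF f x) (≢last (ctF≢ f g gf x))

private
  inject-ctFun : ∀ {m} (f g : Fin (suc m) → Fin (suc m)) (gf : ∀ x → g (f x) ≡ x) x →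
                 inject₁ (ctFun f g gf x) ≡ ctF f x
  inject-ctFun f g gf x = inject₁-lower₁ (ctF f x) _

  ctF-inv : ∀ {m} (f g : Fin (suc m) → Fin (suc m)) → (∀ x → g (f x) ≡ x) →
            (∀ x → f (g x) ≡ x) → ∀ x y → inject₁ y ≡ ctF f x → ctF g y ≡ inject₁ x
  ctF-inv {m} f g gf fg x y eq with f (inject₁ x) ≟ fromℕ m
  ctF-inv {m} f g gf fg x y eq | yes e with g (inject₁ y) ≟ fromℕ m
  ... | yes _ = trans (cong g (sym e)) (gf (inject₁ x))
  ... | no ne = ⊥-elim (ne (trans (cong g eq) (gf (fromℕ m))))
  ctF-inv {m} f g gf fg x y eq | no ne with g (inject₁ y) ≟ fromℕ m
  ... | yes e′ = ⊥-elim (fromℕ≢inject₁ (trans (sym e′) (trans (cong g eq) (gf (inject₁ x)))))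
  ... | no _ = trans (cong g eq) (gf (inject₁ x))

  ctFun-inv : ∀ {m} (f g : Fin (suc m) → Fin (suc m)) (gf : ∀ x → g (f x) ≡ x)
              (fg : ∀ x → f (g x) ≡ x) x → ctFun g f fg (ctFun f g gf x) ≡ x
  ctFun-inv f g gf fg x = inject₁-injective
    (trans (inject-ctFun g f fg _) (ctF-inv f g gf fg x _ (inject-ctFun f g gf x)))

CT : ∀ {m} → Permutation′ (suc m) → Permutation′ m
CT σ = permutation
  (ctFun (σ ⟨$⟩ʳ_) (σ ⟨$⟩ˡ_) (λ x → inverseˡ σ))
  (ctFun (σ ⟨$⟩ˡ_) (σ ⟨$⟩ʳ_) (λ x → inverseʳ σ))
  (ctFun-inv (σ ⟨$⟩ˡ_) (σ ⟨$⟩ʳ_) (λ x → inverseʳ σ) (λ x → inverseˡ σ))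
  (ctFun-inv (σ ⟨$⟩ʳ_) (σ ⟨$⟩ˡ_) (λ x → inverseˡ σ) (λ x → inverseʳ σ))

_⁻¹∙_ : ∀ {n} → Permutation′ n → Permutation′ n → Fin n → Fin n
(σ ⁻¹∙ τ) x = τ ⟨$⟩ʳ (σ ⟨$⟩ˡ x)

-- Removing the point a from its cycle in the cycle decomposition of h:
-- the cycle ( … p a q … ) becomes ( … p q … ) and a is left out (made a fixed
-- point); all other cycles are unchanged.
removeFromCycle : ∀ {n} → Fin n → (Fin n → Fin n) → Fin n → Fin n
removeFromCycle a h y with y ≟ a
... | yes _ = a
... | no  _ with h y ≟ a
...   | yes _ = h a
...   | no  _ = h y

module Submission where

-- Write L = n-1 (the last point of Z_n), h = σ⁻¹τ, p = σ(L), a = σ⁻¹(L), b = τ⁻¹(L).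
--
-- Extend the contraction formula to all of Z_n ('contract', with
-- contract f L = f L).  Then hd(σ^CT,τ^CT) + [σL ≠ τL] = hd(contract σ, contract τ),
-- and contract σ differs from σ only at a, contract τ from τ only at b.  Changing
-- one coordinate of a pair of functions changes their Hamming distance by the
-- change of mismatch at that coordinate ('hdF-update').  If hL = L (i.e. a = b)
-- the two changes happen at the same point and the distance drops by 0 only, so
-- the hypothesis forces hL ≠ L: part (i).  If a ≠ b, the hypothesis becomes the
-- balance [p ≠ hL] + [σb ≠ τL] = [σL ≠ τL], so either p = hL, or h(h p) = L with
-- h p ≠ L.
--
-- On Z_{n-1}, (σ^CT)⁻¹τ^CT is h "rerouted at p": p goes to hL, the
-- h-preimage of L goes to h p, every other point goes as under h ('IsRerouting').
-- In the two cases above a rerouting equals h with L and then p (resp. h p, the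
-- predecessor of L) removed from their cycle: part (ii).

open import Defs
open import Data.Nat using (ℕ; zero; suc; _+_)
open import Data.Nat.Properties
  using (+-comm; +-assoc; +-cancelˡ-≡; +-cancelʳ-≡; m+1+n≢m; +-commutativeSemigroup)
open import Algebra.Properties.CommutativeSemigroup +-commutativeSemigroup using (xy∙z≈xz∙y)
open import Data.Fin using (Fin; fromℕ; inject₁; punchIn; _≟_)
import Data.Fin as Fin
open import Data.Fin.Properties using (fromℕ≢inject₁; inject₁-lower₁; inject₁-injective; punchInᵢ≢i)
open import Data.Fin.Permutation using (Permutation′; _⟨$⟩ʳ_; _⟨$⟩ˡ_; inverseˡ; inverseʳ; flip)
open import Function using (_∘_; Injective; Injection)
open import Function.Properties.Inverse using (↔⇒↣)
open import Data.Product using (_×_; _,_; proj₁; proj₂; ∃-syntax)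
open import Data.Sum using (_⊎_; inj₁; inj₂)
open import Data.Empty using (⊥-elim)
open import Relation.Nullary using (Dec; yes; no)
open import Relation.Binary.PropositionalEquality
  using (_≡_; _≢_; refl; sym; trans; cong; cong₂; module ≡-Reasoning)

mismatch : ∀ {k} → Fin k → Fin k → ℕ
mismatch u v with u ≟ v
... | yes _ = 0
... | no  _ = 1

mismatch-≡ : ∀ {k} {u v : Fin k} → u ≡ v → mismatch u v ≡ 0
mismatch-≡ {u = u} {v} u≡v with u ≟ v
... | yes _   = refl
... | no  u≢v = ⊥-elim (u≢v u≡v)

mismatch-≢ : ∀ {k} {u v : Fin k} → u ≢ v → mismatch u v ≡ 1
mismatch-≢ {u = u} {v} u≢v with u ≟ v
... | yes u≡v = ⊥-elim (u≢v u≡v)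
... | no  _   = refl

mismatch-injective : ∀ {k l} (f : Fin k → Fin l) → Injective _≡_ _≡_ f →
                     ∀ u v → mismatch (f u) (f v) ≡ mismatch u v
mismatch-injective f f-inj u v with u ≟ v
... | yes u≡v = mismatch-≡ (cong f u≡v)
... | no  u≢v = mismatch-≢ (u≢v ∘ f-inj)

mismatch-successor : ∀ {k} (u v w z : Fin k) →
                     suc (mismatch u v) ≡ mismatch w z → u ≡ v × w ≢ z
mismatch-successor u v w z eq with u ≟ v | w ≟ z
... | yes u≡v | no  w≢z = u≡v , w≢z
... | yes _   | yes _   with () ← eq
... | no  _   | yes _   with () ← eq
... | no  _   | no  _   with () ← eq

hdF-suc : ∀ {n k} (f g : Fin (suc n) → Fin k) →
          hdF f g ≡ mismatch (f Fin.zero) (g Fin.zero) + hdF (f ∘ Fin.suc) (g ∘ Fin.suc)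
hdF-suc f g with f Fin.zero ≟ g Fin.zero
... | yes _ = refl
... | no  _ = refl

hdF-ext : ∀ {n k} {f g f′ g′ : Fin n → Fin k} →
          (∀ x → f x ≡ f′ x) → (∀ x → g x ≡ g′ x) → hdF f g ≡ hdF f′ g′
hdF-ext {zero} _ _ = refl
hdF-ext {suc n} {f = f} {g} {f′} {g′} f≗f′ g≗g′ = begin
  hdF f g                                                          ≡⟨ hdF-suc f g ⟩
  mismatch (f Fin.zero) (g Fin.zero) + hdF (f ∘ Fin.suc) (g ∘ Fin.suc)
    ≡⟨ cong₂ _+_ (cong₂ mismatch (f≗f′ Fin.zero) (g≗g′ Fin.zero))
                 (hdF-ext (f≗f′ ∘ Fin.suc) (g≗g′ ∘ Fin.suc)) ⟩
  mismatch (f′ Fin.zero) (g′ Fin.zero) + hdF (f′ ∘ Fin.suc) (g′ ∘ Fin.suc) ≡⟨ sym (hdF-suc f′ g′) ⟩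
  hdF f′ g′                                                        ∎
  where open ≡-Reasoning

hdF-injective : ∀ {n k l} (i : Fin k → Fin l) → Injective _≡_ _≡_ i →
                (f g : Fin n → Fin k) → hdF (i ∘ f) (i ∘ g) ≡ hdF f g
hdF-injective {zero} i i-inj f g = refl
hdF-injective {suc n} i i-inj f g = begin
  hdF (i ∘ f) (i ∘ g)                                                         ≡⟨ hdF-suc (i ∘ f) (i ∘ g) ⟩
  mismatch (i (f Fin.zero)) (i (g Fin.zero)) + hdF (i ∘ f ∘ Fin.suc) (i ∘ g ∘ Fin.suc)
    ≡⟨ cong₂ _+_ (mismatch-injective i i-inj (f Fin.zero) (g Fin.zero))
                 (hdF-injective i i-inj (f ∘ Fin.suc) (g ∘ Fin.suc)) ⟩
  mismatch (f Fin.zero) (g Fin.zero) + hdF (f ∘ Fin.suc) (g ∘ Fin.suc)       ≡⟨ sym (hdF-suc f g) ⟩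
  hdF f g                                                                     ∎
  where open ≡-Reasoning

hdF-split : ∀ {n k} (f g : Fin (suc n) → Fin k) (i : Fin (suc n)) →
            hdF f g ≡ hdF (f ∘ punchIn i) (g ∘ punchIn i) + mismatch (f i) (g i)
hdF-split f g Fin.zero =
  trans (hdF-suc f g) (+-comm (mismatch (f Fin.zero) (g Fin.zero)) _)
hdF-split {suc n} f g (Fin.suc i) = begin
  hdF f g                                        ≡⟨ hdF-suc f g ⟩
  m₀ + hdF (f ∘ Fin.suc) (g ∘ Fin.suc)          ≡⟨ cong (m₀ +_) (hdF-split (f ∘ Fin.suc) (g ∘ Fin.suc) i) ⟩
  m₀ + (rest + mᵢ)                               ≡⟨ sym (+-assoc m₀ rest mᵢ) ⟩
  (m₀ + rest) + mᵢ                               ≡⟨ cong (_+ mᵢ) (sym (hdF-suc (f ∘ punchIn (Fin.suc i)) (g ∘ punchIn (Fin.suc i)))) ⟩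
  hdF (f ∘ punchIn (Fin.suc i)) (g ∘ punchIn (Fin.suc i)) + mᵢ ∎
  where
  open ≡-Reasoning
  m₀   = mismatch (f Fin.zero) (g Fin.zero)
  mᵢ   = mismatch (f (Fin.suc i)) (g (Fin.suc i))
  rest = hdF (f ∘ Fin.suc ∘ punchIn i) (g ∘ Fin.suc ∘ punchIn i)

punchIn-last : ∀ {n} (j : Fin n) → punchIn (fromℕ n) j ≡ inject₁ j
punchIn-last Fin.zero    = refl
punchIn-last (Fin.suc j) = cong Fin.suc (punchIn-last j)

hdF-last : ∀ {n k} (f g : Fin (suc n) → Fin k) →
           hdF f g ≡ hdF (f ∘ inject₁) (g ∘ inject₁) + mismatch (f (fromℕ n)) (g (fromℕ n))
hdF-last {n} f g = trans (hdF-split f g (fromℕ n))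
  (cong (_+ mismatch (f (fromℕ n)) (g (fromℕ n)))
        (hdF-ext (cong f ∘ punchIn-last) (cong g ∘ punchIn-last)))

hdF-update : ∀ {n k} {f g f′ g′ : Fin n → Fin k} (i : Fin n) →
             (∀ x → x ≢ i → f x ≡ f′ x) → (∀ x → x ≢ i → g x ≡ g′ x) →
             hdF f g + mismatch (f′ i) (g′ i) ≡ hdF f′ g′ + mismatch (f i) (g i)
hdF-update {suc n} {f = f} {g} {f′} {g′} i f≈f′ g≈g′ = begin
  hdF f g + mismatch (f′ i) (g′ i)                                  ≡⟨ cong (_+ _) (hdF-split f g i) ⟩
  (rest + mismatch (f i) (g i)) + mismatch (f′ i) (g′ i)            ≡⟨ xy∙z≈xz∙y rest _ _ ⟩
  (rest + mismatch (f′ i) (g′ i)) + mismatch (f i) (g i)            ≡⟨ cong (λ r → (r + _) + _) rest≡rest′ ⟩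
  (hdF (f′ ∘ punchIn i) (g′ ∘ punchIn i) + mismatch (f′ i) (g′ i)) + mismatch (f i) (g i)
    ≡⟨ cong (_+ _) (sym (hdF-split f′ g′ i)) ⟩
  hdF f′ g′ + mismatch (f i) (g i)                                  ∎
  where
  open ≡-Reasoning
  rest = hdF (f ∘ punchIn i) (g ∘ punchIn i)
  rest≡rest′ : rest ≡ hdF (f′ ∘ punchIn i) (g′ ∘ punchIn i)
  rest≡rest′ = hdF-ext (λ x → f≈f′ _ (punchInᵢ≢i i x)) (λ x → g≈g′ _ (punchInᵢ≢i i x))

contract : ∀ {m} → (Fin (suc m) → Fin (suc m)) → Fin (suc m) → Fin (suc m)
contract {m} f u with f u ≟ fromℕ m
... | yes _ = f (fromℕ m)
... | no  _ = f u

contract-hit : ∀ {m} (f : Fin (suc m) → Fin (suc m)) {u} → f u ≡ fromℕ m → contract f u ≡ f (fromℕ m)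
contract-hit {m} f {u} fu≡L with f u ≟ fromℕ m
... | yes _    = refl
... | no fu≢L = ⊥-elim (fu≢L fu≡L)

contract-miss : ∀ {m} (f : Fin (suc m) → Fin (suc m)) {u} → f u ≢ fromℕ m → contract f u ≡ f u
contract-miss {m} f {u} fu≢L with f u ≟ fromℕ m
... | yes fu≡L = ⊥-elim (fu≢L fu≡L)
... | no  _    = refl

contract-last : ∀ {m} (f : Fin (suc m) → Fin (suc m)) → contract f (fromℕ m) ≡ f (fromℕ m)
contract-last {m} f with f (fromℕ m) ≟ fromℕ m
... | yes _ = refl
... | no  _ = refl

ctF-contract : ∀ {m} (f : Fin (suc m) → Fin (suc m)) (x : Fin m) → ctF f x ≡ contract f (inject₁ x)
ctF-contract {m} f x with f (inject₁ x) ≟ fromℕ m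
... | yes _ = refl
... | no  _ = refl

inject₁-ctFun : ∀ {m} (f g : Fin (suc m) → Fin (suc m)) (gf : ∀ x → g (f x) ≡ x) (x : Fin m) →
                inject₁ (ctFun f g gf x) ≡ contract f (inject₁ x)
inject₁-ctFun f g gf x = trans (inject₁-lower₁ _ _) (ctF-contract f x)

inject₁≢last : ∀ {m} (x : Fin m) → inject₁ x ≢ fromℕ m
inject₁≢last x = fromℕ≢inject₁ ∘ sym

perm-injective : ∀ {n} (π : Permutation′ n) → Injective _≡_ _≡_ (π ⟨$⟩ʳ_)
perm-injective π = Injection.injective (↔⇒↣ π)

contract-off : ∀ {m} (π : Permutation′ (suc m)) {x} → x ≢ π ⟨$⟩ˡ fromℕ m →
               contract (π ⟨$⟩ʳ_) x ≡ π ⟨$⟩ʳ x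
contract-off π x≢π⁻¹L = contract-miss (π ⟨$⟩ʳ_)
  (λ πx≡L → x≢π⁻¹L (trans (sym (inverseˡ π)) (cong (π ⟨$⟩ˡ_) πx≡L)))

contract-at : ∀ {m} (π : Permutation′ (suc m)) →
              contract (π ⟨$⟩ʳ_) (π ⟨$⟩ˡ fromℕ m) ≡ π ⟨$⟩ʳ fromℕ m
contract-at π = contract-hit (π ⟨$⟩ʳ_) (inverseʳ π)

removeFromCycle-self : ∀ {n} (a : Fin n) h → removeFromCycle a h a ≡ a
removeFromCycle-self a h with a ≟ a
... | yes _   = refl
... | no  a≢a = ⊥-elim (a≢a refl)

removeFromCycle-pre : ∀ {n} (a : Fin n) h {y} → y ≢ a → h y ≡ a → removeFromCycle a h y ≡ h a
removeFromCycle-pre a h {y} y≢a hy≡a with y ≟ a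
... | yes y≡a = ⊥-elim (y≢a y≡a)
... | no  _ with h y ≟ a
...   | yes _    = refl
...   | no hy≢a = ⊥-elim (hy≢a hy≡a)

removeFromCycle-other : ∀ {n} (a : Fin n) h {y} → y ≢ a → h y ≢ a → removeFromCycle a h y ≡ h y
removeFromCycle-other a h {y} y≢a hy≢a with y ≟ a
... | yes y≡a = ⊥-elim (y≢a y≡a)
... | no  _ with h y ≟ a
...   | yes hy≡a = ⊥-elim (hy≢a hy≡a)
...   | no  _    = refl

-- This is the shape of (σ^CT)⁻¹τ^CT in terms of σ⁻¹τ and p = σ(L).
record IsRerouting {n} (h : Fin n → Fin n) (L p : Fin n) (g : Fin n → Fin n) : Set where
  field
    at-p      : g p ≡ h L
    at-pre    : ∀ {y} → y ≢ p → h y ≡ L → g y ≡ h p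
    elsewhere : ∀ {y} → y ≢ p → h y ≢ L → g y ≡ h y

rerouting-successor : ∀ {n} {h g : Fin n → Fin n} {L p : Fin n} →
  Injective _≡_ _≡_ h → IsRerouting h L p g → h L ≡ p → h L ≢ L →
  ∀ y → y ≢ L → g y ≡ removeFromCycle p (removeFromCycle L h) y
rerouting-successor {h = h} {g} {L} {p} h-inj r hL≡p hL≢L y y≢L = by-cases (y ≟ p) (h y ≟ L)
  where
  open IsRerouting r
  open ≡-Reasoning
  R : Fin _ → Fin _
  R = removeFromCycle p (removeFromCycle L h)
  p≢L : p ≢ L
  p≢L p≡L = hL≢L (trans hL≡p p≡L)
  by-cases : Dec (y ≡ p) → Dec (h y ≡ L) → g y ≡ R y
  by-cases (yes y≡p) _ = begin
    g y  ≡⟨ cong g y≡p ⟩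
    g p  ≡⟨ trans at-p hL≡p ⟩
    p    ≡⟨ sym (removeFromCycle-self p _) ⟩
    R p  ≡⟨ cong R (sym y≡p) ⟩
    R y  ∎
  by-cases (no y≢p) (yes hy≡L) = begin
    g y                    ≡⟨ at-pre y≢p hy≡L ⟩
    h p                    ≡⟨ sym (removeFromCycle-other L h p≢L hp≢L) ⟩
    removeFromCycle L h p  ≡⟨ sym (removeFromCycle-pre p _ y≢p L-pred-to-p) ⟩
    R y                    ∎
    where
    hp≢L : h p ≢ L
    hp≢L hp≡L = y≢p (h-inj (trans hy≡L (sym hp≡L)))
    L-pred-to-p : removeFromCycle L h y ≡ p
    L-pred-to-p = trans (removeFromCycle-pre L h y≢L hy≡L) hL≡p
  by-cases (no y≢p) (no hy≢L) = begin
    g y  ≡⟨ elsewhere y≢p hy≢L ⟩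
    h y  ≡⟨ sym (trans (removeFromCycle-other p _ y≢p (λ e → hy≢p (trans (sym r-y) e))) r-y) ⟩
    R y  ∎
    where
    r-y : removeFromCycle L h y ≡ h y
    r-y = removeFromCycle-other L h y≢L hy≢L
    hy≢p : h y ≢ p
    hy≢p hy≡p = y≢L (h-inj (trans hy≡p (sym hL≡p)))

rerouting-predecessor : ∀ {n} {h g : Fin n → Fin n} {L p : Fin n} →
  Injective _≡_ _≡_ h → IsRerouting h L p g → h (h p) ≡ L → h p ≢ L →
  ∀ y → y ≢ L → g y ≡ removeFromCycle (h p) (removeFromCycle L h) y
rerouting-predecessor {h = h} {g} {L} {p} h-inj r hc≡L c≢L y y≢L = by-cases (y ≟ p) (h y ≟ L)
  where
  open IsRerouting r
  open ≡-Reasoning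
  c : Fin _
  c = h p
  R : Fin _ → Fin _
  R = removeFromCycle c (removeFromCycle L h)
  by-cases : Dec (y ≡ p) → Dec (h y ≡ L) → g y ≡ R y
  by-cases (yes y≡p) _ = begin
    g y                    ≡⟨ cong g y≡p ⟩
    g p                    ≡⟨ at-p ⟩
    h L                    ≡⟨ sym (removeFromCycle-pre L h c≢L hc≡L) ⟩
    removeFromCycle L h c  ≡⟨ sym (removeFromCycle-pre c _ p≢c L-succ-p) ⟩
    R p                    ≡⟨ cong R (sym y≡p) ⟩
    R y                    ∎
    where
    p≢L : p ≢ L
    p≢L p≡L = y≢L (trans y≡p p≡L)
    p≢c : p ≢ c
    p≢c p≡c = c≢L (trans (cong h p≡c) hc≡L)
    L-succ-p : removeFromCycle L h p ≡ c
    L-succ-p = removeFromCycle-other L h p≢L c≢L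
  by-cases (no y≢p) (yes hy≡L) = begin
    g y  ≡⟨ at-pre y≢p hy≡L ⟩
    c    ≡⟨ sym (removeFromCycle-self c _) ⟩
    R c  ≡⟨ cong R (sym (h-inj (trans hy≡L (sym hc≡L)))) ⟩
    R y  ∎
  by-cases (no y≢p) (no hy≢L) = begin
    g y  ≡⟨ elsewhere y≢p hy≢L ⟩
    h y  ≡⟨ sym (trans (removeFromCycle-other c _ y≢c (λ e → y≢p (h-inj (trans (sym r-y) e)))) r-y) ⟩
    R y  ∎
    where
    r-y : removeFromCycle L h y ≡ h y
    r-y = removeFromCycle-other L h y≢L hy≢L
    y≢c : y ≢ c
    y≢c y≡c = hy≢L (trans (cong h y≡c) hc≡L)

module Contraction {m : ℕ} (σ τ : Permutation′ (suc m)) where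
  L : Fin (suc m)
  L = fromℕ m

  h : Fin (suc m) → Fin (suc m)
  h = σ ⁻¹∙ τ

  p a b : Fin (suc m)
  p = σ ⟨$⟩ʳ L
  a = σ ⟨$⟩ˡ L
  b = τ ⟨$⟩ˡ L

  S M Ĥ : ℕ
  S = hd σ τ
  M = hdF (contract (σ ⟨$⟩ʳ_)) (τ ⟨$⟩ʳ_)
  Ĥ = hdF (contract (σ ⟨$⟩ʳ_)) (contract (τ ⟨$⟩ʳ_))

  h-injective : Injective _≡_ _≡_ h
  h-injective = perm-injective (flip σ) ∘ perm-injective τ

  τ⁻¹-last : ∀ {x} → τ ⟨$⟩ʳ x ≡ L → x ≡ b
  τ⁻¹-last τx≡L = trans (sym (inverseˡ τ)) (cong (τ ⟨$⟩ˡ_) τx≡L)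

  hd-CT : hd (CT σ) (CT τ) + mismatch (σ ⟨$⟩ʳ L) (τ ⟨$⟩ʳ L) ≡ Ĥ
  hd-CT = begin
    hd (CT σ) (CT τ) + mismatch (σ ⟨$⟩ʳ L) (τ ⟨$⟩ʳ L)
      ≡⟨ cong₂ _+_ (sym (hdF-injective inject₁ inject₁-injective (CT σ ⟨$⟩ʳ_) (CT τ ⟨$⟩ʳ_)))
                   (sym (cong₂ mismatch (contract-last (σ ⟨$⟩ʳ_)) (contract-last (τ ⟨$⟩ʳ_)))) ⟩
    hdF (inject₁ ∘ (CT σ ⟨$⟩ʳ_)) (inject₁ ∘ (CT τ ⟨$⟩ʳ_))
      + mismatch (contract (σ ⟨$⟩ʳ_) L) (contract (τ ⟨$⟩ʳ_) L)
      ≡⟨ cong (_+ mismatch (contract (σ ⟨$⟩ʳ_) L) (contract (τ ⟨$⟩ʳ_) L))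
              (hdF-ext (inject₁-ctFun (σ ⟨$⟩ʳ_) (σ ⟨$⟩ˡ_) (λ _ → inverseˡ σ))
                       (inject₁-ctFun (τ ⟨$⟩ʳ_) (τ ⟨$⟩ˡ_) (λ _ → inverseˡ τ))) ⟩
    hdF (contract (σ ⟨$⟩ʳ_) ∘ inject₁) (contract (τ ⟨$⟩ʳ_) ∘ inject₁)
      + mismatch (contract (σ ⟨$⟩ʳ_) L) (contract (τ ⟨$⟩ʳ_) L)
      ≡⟨ sym (hdF-last (contract (σ ⟨$⟩ʳ_)) (contract (τ ⟨$⟩ʳ_))) ⟩
    Ĥ ∎
    where open ≡-Reasoning

  -- Part (i): if hL = L then a = b, both contractions change the pair only at a,
  -- and the distance drops by the mismatch at L alone, not by 2.
  last-moves : hd (CT σ) (CT τ) + 2 ≡ S → h L ≢ L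
  last-moves hyp hL≡L = m+1+n≢m (hd (CT σ) (CT τ)) (+-cancelʳ-≡ mL _ _ (begin
    hd (CT σ) (CT τ) + 2 + mL  ≡⟨ cong (_+ mL) hyp ⟩
    S + mL                      ≡⟨ cong (S +_) (cong₂ mismatch (sym (contract-at σ)) (sym contract-τ-a)) ⟩
    S + mismatch (contract (σ ⟨$⟩ʳ_) a) (contract (τ ⟨$⟩ʳ_) a)
      ≡⟨ hdF-update {f = σ ⟨$⟩ʳ_} {τ ⟨$⟩ʳ_} {contract (σ ⟨$⟩ʳ_)} {contract (τ ⟨$⟩ʳ_)} a
           (λ _ x≢a → sym (contract-off σ x≢a)) (λ _ x≢a → sym (contract-off τ (x≢b x≢a)))  ⟩
    Ĥ + mismatch (σ ⟨$⟩ʳ a) (τ ⟨$⟩ʳ a)  ≡⟨ cong (Ĥ +_) (mismatch-≡ (trans (inverseʳ σ) (sym hL≡L))) ⟩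
    Ĥ + 0                       ≡⟨ +-comm Ĥ 0 ⟩
    Ĥ                           ≡⟨ sym hd-CT ⟩
    hd (CT σ) (CT τ) + mL       ∎))
    where
    open ≡-Reasoning
    mL = mismatch (σ ⟨$⟩ʳ L) (τ ⟨$⟩ʳ L)
    a≡b : a ≡ b
    a≡b = τ⁻¹-last hL≡L
    x≢b : ∀ {x} → x ≢ a → x ≢ b
    x≢b x≢a x≡b = x≢a (trans x≡b (sym a≡b))
    contract-τ-a : contract (τ ⟨$⟩ʳ_) a ≡ τ ⟨$⟩ʳ L
    contract-τ-a = trans (cong (contract (τ ⟨$⟩ʳ_)) a≡b) (contract-at τ)

  -- If hL ≠ L, the contractions change the pair at the two distinct points a and
  -- b, and the hypothesis balances the three mismatches involved.
  mismatch-balance : h L ≢ L → hd (CT σ) (CT τ) + 2 ≡ S →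
    mismatch p (h L) + mismatch (σ ⟨$⟩ʳ b) (τ ⟨$⟩ʳ L) ≡ mismatch (σ ⟨$⟩ʳ L) (τ ⟨$⟩ʳ L)
  mismatch-balance hL≢L hyp = +-cancelˡ-≡ (H + 2) _ _ (begin
    (H + 2) + (d₁ + d₂)  ≡⟨ cong (_+ (d₁ + d₂)) hyp ⟩
    S + (d₁ + d₂)        ≡⟨ sym (+-assoc S d₁ d₂) ⟩
    (S + d₁) + d₂        ≡⟨ cong (_+ d₂) contract-σ-step ⟩
    (M + 1) + d₂         ≡⟨ xy∙z≈xz∙y M 1 d₂ ⟩
    (M + d₂) + 1         ≡⟨ cong (_+ 1) contract-τ-step ⟩
    (Ĥ + 1) + 1          ≡⟨ +-assoc Ĥ 1 1 ⟩
    Ĥ + 2                ≡⟨ cong (_+ 2) (sym hd-CT) ⟩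
    (H + d₃) + 2         ≡⟨ xy∙z≈xz∙y H d₃ 2 ⟩
    (H + 2) + d₃         ∎)
    where
    open ≡-Reasoning
    H  = hd (CT σ) (CT τ)
    d₁ = mismatch p (h L)
    d₂ = mismatch (σ ⟨$⟩ʳ b) (τ ⟨$⟩ʳ L)
    d₃ = mismatch (σ ⟨$⟩ʳ L) (τ ⟨$⟩ʳ L)
    b≢a : b ≢ a
    b≢a b≡a = hL≢L (trans (cong (τ ⟨$⟩ʳ_) (sym b≡a)) (inverseʳ τ))
    σb≢L : σ ⟨$⟩ʳ b ≢ L
    σb≢L σb≡L = b≢a (trans (sym (inverseˡ σ)) (cong (σ ⟨$⟩ˡ_) σb≡L))
    contract-σ-step : S + d₁ ≡ M + 1
    contract-σ-step = begin
      S + d₁  ≡⟨ cong (λ v → S + mismatch v (h L)) (sym (contract-at σ)) ⟩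
      S + mismatch (contract (σ ⟨$⟩ʳ_) a) (τ ⟨$⟩ʳ a)
        ≡⟨ hdF-update {f = σ ⟨$⟩ʳ_} {τ ⟨$⟩ʳ_} {contract (σ ⟨$⟩ʳ_)} {τ ⟨$⟩ʳ_} a
             (λ _ x≢a → sym (contract-off σ x≢a)) (λ _ _ → refl) ⟩
      M + mismatch (σ ⟨$⟩ʳ a) (τ ⟨$⟩ʳ a)  ≡⟨ cong (M +_) (mismatch-≢ (λ e → hL≢L (trans (sym e) (inverseʳ σ)))) ⟩
      M + 1   ∎
    contract-τ-step : M + d₂ ≡ Ĥ + 1
    contract-τ-step = begin
      M + d₂  ≡⟨ cong (M +_) (cong₂ mismatch (sym (contract-off σ b≢a)) (sym (contract-at τ))) ⟩
      M + mismatch (contract (σ ⟨$⟩ʳ_) b) (contract (τ ⟨$⟩ʳ_) b)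
        ≡⟨ hdF-update {f = contract (σ ⟨$⟩ʳ_)} {τ ⟨$⟩ʳ_} {contract (σ ⟨$⟩ʳ_)} {contract (τ ⟨$⟩ʳ_)} b
             (λ _ _ → refl) (λ _ x≢b → sym (contract-off τ x≢b)) ⟩
      Ĥ + mismatch (contract (σ ⟨$⟩ʳ_) b) (τ ⟨$⟩ʳ b)
        ≡⟨ cong (Ĥ +_) (mismatch-≢ (λ e → σb≢L (trans (trans (sym (contract-off σ b≢a)) e) (inverseʳ τ)))) ⟩
      Ĥ + 1   ∎

  -- When p ≠ hL, the balance forces σ(b) = τ(L) ≠ σ(L): then h p = τ(L) is the
  -- predecessor of L in its cycle and differs from L.
  predecessor-case : p ≢ h L →
    mismatch p (h L) + mismatch (σ ⟨$⟩ʳ b) (τ ⟨$⟩ʳ L) ≡ mismatch (σ ⟨$⟩ʳ L) (τ ⟨$⟩ʳ L) →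
    h (h p) ≡ L × h p ≢ L
  predecessor-case p≢hL balance = hhp≡L , hp≢L
    where
    open ≡-Reasoning
    σb≡τL×σL≢τL = mismatch-successor _ _ _ _ (trans (cong (_+ mismatch (σ ⟨$⟩ʳ b) (τ ⟨$⟩ʳ L)) (sym (mismatch-≢ p≢hL))) balance)
    σb≡τL : σ ⟨$⟩ʳ b ≡ τ ⟨$⟩ʳ L
    σb≡τL = proj₁ σb≡τL×σL≢τL
    hp≡τL : h p ≡ τ ⟨$⟩ʳ L
    hp≡τL = cong (τ ⟨$⟩ʳ_) (inverseˡ σ)
    hhp≡L : h (h p) ≡ L
    hhp≡L = begin
      τ ⟨$⟩ʳ (σ ⟨$⟩ˡ h p)            ≡⟨ cong (λ v → τ ⟨$⟩ʳ (σ ⟨$⟩ˡ v)) (trans hp≡τL (sym σb≡τL)) ⟩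
      τ ⟨$⟩ʳ (σ ⟨$⟩ˡ (σ ⟨$⟩ʳ b))     ≡⟨ cong (τ ⟨$⟩ʳ_) (inverseˡ σ) ⟩
      τ ⟨$⟩ʳ b                        ≡⟨ inverseʳ τ ⟩
      L                               ∎
    hp≢L : h p ≢ L
    hp≢L hp≡L = proj₂ σb≡τL×σL≢τL (begin
      σ ⟨$⟩ʳ L  ≡⟨ cong (σ ⟨$⟩ʳ_) (τ⁻¹-last (trans (sym hp≡τL) hp≡L)) ⟩
      σ ⟨$⟩ʳ b  ≡⟨ σb≡τL ⟩
      τ ⟨$⟩ʳ L  ∎)

  quotient-contract : ∀ x → inject₁ ((CT σ ⁻¹∙ CT τ) x)
                            ≡ contract (τ ⟨$⟩ʳ_) (contract (σ ⟨$⟩ˡ_) (inject₁ x))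
  quotient-contract x = trans (inject₁-ctFun (τ ⟨$⟩ʳ_) (τ ⟨$⟩ˡ_) (λ _ → inverseˡ τ) _)
    (cong (contract (τ ⟨$⟩ʳ_)) (inject₁-ctFun (σ ⟨$⟩ˡ_) (σ ⟨$⟩ʳ_) (λ _ → inverseʳ σ) x))

  quotient-reroutes : h L ≢ L → IsRerouting h L p (contract (τ ⟨$⟩ʳ_) ∘ contract (σ ⟨$⟩ˡ_))
  quotient-reroutes hL≢L = record
    { at-p      = trans (cong (contract (τ ⟨$⟩ʳ_)) (contract-at (flip σ))) (contract-miss (τ ⟨$⟩ʳ_) hL≢L)
    ; at-pre    = λ y≢p hy≡L → trans (cong (contract (τ ⟨$⟩ʳ_)) (contract-off (flip σ) y≢p))
                                      (trans (contract-hit (τ ⟨$⟩ʳ_) hy≡L) (cong (τ ⟨$⟩ʳ_) (sym (inverseˡ σ))))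
    ; elsewhere = λ y≢p hy≢L → trans (cong (contract (τ ⟨$⟩ʳ_)) (contract-off (flip σ) y≢p))
                                      (contract-miss (τ ⟨$⟩ʳ_) hy≢L)
    }

  cycle-structure : hd (CT σ) (CT τ) + 2 ≡ S →
    ∃[ c ] ((c ≡ h L ⊎ h c ≡ L)
      × (∀ (x : Fin m) → inject₁ ((CT σ ⁻¹∙ CT τ) x) ≡ removeFromCycle c (removeFromCycle L h) (inject₁ x)))
  cycle-structure hyp with p ≟ h L
  ... | yes p≡hL = p , inj₁ p≡hL , λ x → trans (quotient-contract x)
          (rerouting-successor h-injective (quotient-reroutes hL≢L) (sym p≡hL) hL≢L
                               (inject₁ x) (inject₁≢last x))
    where hL≢L = last-moves hyp
  ... | no p≢hL = h p , inj₂ hhp≡L , λ x → trans (quotient-contract x)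
          (rerouting-predecessor h-injective (quotient-reroutes hL≢L) hhp≡L hp≢L
                                 (inject₁ x) (inject₁≢last x))
    where
    hL≢L = last-moves hyp
    hhp≡L×hp≢L = predecessor-case p≢hL (mismatch-balance hL≢L hyp)
    hhp≡L = proj₁ hhp≡L×hp≢L
    hp≢L  = proj₂ hhp≡L×hp≢L

lemma4 : (m : ℕ) (σ τ : Permutation′ (suc m)) →
    hd (CT σ) (CT τ) + 2 ≡ hd σ τ →
    ((σ ⁻¹∙ τ) (fromℕ m) ≢ fromℕ m)
    × (∃[ a ] ((a ≡ (σ ⁻¹∙ τ) (fromℕ m) ⊎ (σ ⁻¹∙ τ) a ≡ fromℕ m)
        × (∀ (x : Fin m) → inject₁ ((CT σ ⁻¹∙ CT τ) x)
             ≡ removeFromCycle a (removeFromCycle (fromℕ m) (σ ⁻¹∙ τ)) (inject₁ x))))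
lemma4 m σ τ hyp = last-moves hyp , cycle-structure hyp
  where open Contraction σ τ
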